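{- Let $(A,\to,1)$ be an algebra of type $(2,0)$ satisfying (Re), (M) and (Ex). Then (**) $\Leftrightarrow$ (Tr).
   Context: Properties, for all $x,y,z\in A$: (Re) $x\to x=1$; (M) $1\to x=x$; (Ex) $x\to(y\to z)=y\to(x\to z)$; (**) $y\to z=1\Rightarrow (z\to x)\to(y\to x)=1$; (Tr) $x\to y=1$ and $y\to z=1$ imply $x\to z=1$. -}

module Defs where

open import Level using (Level)
open import Relation.Binary.PropositionalEquality using (_≡_)

record Algebra20 {a : Level} (A : Set a) : Set a where
  field
    _⇒_ : A → A → A
    𝟏   : A
  infixr 5 _⇒_

module _ {a : Level} {A : Set a} (𝔸 : Algebra20 A) where
  open Algebra20 𝔸

  Re : Set a
  Re = ∀ x → (x ⇒ x) ≡ 𝟏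

  M : Set a
  M = ∀ x → (𝟏 ⇒ x) ≡ x

  Ex : Set a
  Ex = ∀ x y z → (x ⇒ (y ⇒ z)) ≡ (y ⇒ (x ⇒ z))

  StarStar : Set a
  StarStar = ∀ x y z → (y ⇒ z) ≡ 𝟏 → ((z ⇒ x) ⇒ (y ⇒ x)) ≡ 𝟏

  Tr : Set a
  Tr = ∀ x y z → (x ⇒ y) ≡ 𝟏 → (y ⇒ z) ≡ 𝟏 → (x ⇒ z) ≡ 𝟏

-- (**) ⇒ (Tr): apply (**) to x → y = 1 and substitute y → z = 1; then (M) turns 1 → (x → z) into x → z.
-- (Tr) ⇒ (**): by (Ex) the goal (z → x) → (y → x) equals y → ((z → x) → x), which is (Tr)
-- applied to y → z = 1 and z → ((z → x) → x) = 1, the latter being (Re) after an exchange.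
module Submission where

open import Defs
open import Level using (Level)
open import Data.Product using (_×_; _,_)
open import Relation.Binary.PropositionalEquality using (_≡_; cong; sym; trans; module ≡-Reasoning)

module _ {a : Level} {A : Set a} (𝔸 : Algebra20 A) where
  open Algebra20 𝔸

  StarStar⇒Tr : M 𝔸 → StarStar 𝔸 → Tr 𝔸
  StarStar⇒Tr m starStar x y z x⇒y≡𝟏 y⇒z≡𝟏 = begin
    x ⇒ z             ≡⟨ sym (m (x ⇒ z)) ⟩
    𝟏 ⇒ (x ⇒ z)       ≡⟨ cong (_⇒ (x ⇒ z)) (sym y⇒z≡𝟏) ⟩
    (y ⇒ z) ⇒ (x ⇒ z) ≡⟨ starStar z x y x⇒y≡𝟏 ⟩
    𝟏                 ∎
    where open ≡-Reasoning

  ⇒-inflationary : Re 𝔸 → Ex 𝔸 → ∀ x y → y ⇒ ((y ⇒ x) ⇒ x) ≡ 𝟏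
  ⇒-inflationary re ex x y = trans (ex y (y ⇒ x) x) (re (y ⇒ x))

  Tr⇒StarStar : Re 𝔸 → Ex 𝔸 → Tr 𝔸 → StarStar 𝔸
  Tr⇒StarStar re ex tr x y z y⇒z≡𝟏 = begin
    (z ⇒ x) ⇒ (y ⇒ x) ≡⟨ ex (z ⇒ x) y x ⟩
    y ⇒ ((z ⇒ x) ⇒ x) ≡⟨ tr y z ((z ⇒ x) ⇒ x) y⇒z≡𝟏 (⇒-inflationary re ex x z) ⟩
    𝟏                 ∎
    where open ≡-Reasoning

theorem2p3 : {a : Level} {A : Set a} (𝔸 : Algebra20 A) →
    Re 𝔸 → M 𝔸 → Ex 𝔸 →
    (StarStar 𝔸 → Tr 𝔸) × (Tr 𝔸 → StarStar 𝔸)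
theorem2p3 𝔸 re m ex = StarStar⇒Tr 𝔸 m , Tr⇒StarStar 𝔸 re ex
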